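{- Let $T$ be a tree. Then (1) ${\mathbf S}_T(q,r) = {\mathbf K}_T(qr,\,q(1-r))$, and (2) ${\mathbf K}_T(x,y) = {\mathbf S}_T\big(x+y,\,x/(x+y)\big)$.
   Context: Identify subtrees of a tree $T$ with their edge sets. The subtree polynomial is ${\mathbf S}_T(q,r)=\sum_S q^{\#S} r^{\#L(S)}$, summed over all subtrees $S$ of $T$ with at least one edge, where $\#S$ is the number of edges of $S$ and $L(S)$ is the set of leaf edges of $S$ (edges incident to a degree-1 vertex of $S$). For nonempty $A\subseteq E(T)$, the connector $K(A)$ is the unique minimal subset of $E(T)\setminus A$ such that $A\cup K(A)$ is a tree. The connector polynomial is ${\mathbf K}_T(x,y)=\sum_{\emptyset\neq A\subseteq E(T)} x^{\#A}y^{\#K(A)}$. -}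

module Defs where

open import Data.Nat using (ℕ; zero; suc; _≤_)
open import Data.Bool using (Bool; true; false; _∧_; _∨_; not; if_then_else_)
open import Data.Fin using (Fin; zero; suc; toℕ; inject₁)
open import Data.Fin.Properties using (_≟_)
open import Data.Vec using (Vec; []; _∷_; lookup; tabulate; zipWith; replicate; foldr)
open import Data.List using (List; []; _∷_; [_]; map; _++_)
import Data.List as List
open import Relation.Nullary.Decidable using (⌊_⌋)
open import Data.Rational using (ℚ; 0ℚ; 1ℚ; _+_; _*_)

-- A tree with n edges on the vertex set Fin (suc n) is presented by a
-- parent function: edge i (for i : Fin n) joins vertex (suc i) to the
-- vertex (parent i), whose index is at most that of i.  Every finite
-- tree is isomorphic to one of this form (label vertices in BFS order
-- from any root), and both polynomials are isomorphism invariants.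

record Tree (n : ℕ) : Set where
  field
    parent   : Fin n → Fin (suc n)
    parent≤  : ∀ i → toℕ (parent i) ≤ toℕ i

open Tree public

end₁ : ∀ {n} → Tree n → Fin n → Fin (suc n)
end₁ T i = suc i

end₂ : ∀ {n} → Tree n → Fin n → Fin (suc n)
end₂ T i = parent T i

EdgeSet : ℕ → Set
EdgeSet n = Vec Bool n

allSubsets : (n : ℕ) → List (EdgeSet n)
allSubsets zero    = [ [] ]
allSubsets (suc n) = map (true ∷_) (allSubsets n) ++ map (false ∷_) (allSubsets n)

card : ∀ {n} → EdgeSet n → ℕ
card = foldr _ (λ b k → if b then suc k else k) 0

anyV : ∀ {n} → Vec Bool n → Bool
anyV = foldr _ _∨_ false

allV : ∀ {n} → Vec Bool n → Bool
allV = foldr _ _∧_ true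

nonempty : ∀ {n} → EdgeSet n → Bool
nonempty = anyV

_∪_ : ∀ {n} → EdgeSet n → EdgeSet n → EdgeSet n
_∪_ = zipWith _∨_

disjoint : ∀ {n} → EdgeSet n → EdgeSet n → Bool
disjoint A B = not (anyV (zipWith _∧_ A B))

_⊆ᵇ_ : ∀ {n} → EdgeSet n → EdgeSet n → Bool
A ⊆ᵇ B = allV (zipWith (λ a b → not a ∨ b) A B)

eqᵇ : Bool → Bool → Bool
eqᵇ true  b = b
eqᵇ false b = not b

_==_ : ∀ {n} → EdgeSet n → EdgeSet n → Bool
A == B = allV (zipWith eqᵇ A B)

incident : ∀ {n} → Tree n → Fin n → Fin (suc n) → Bool
incident T i v = ⌊ end₁ T i ≟ v ⌋ ∨ ⌊ end₂ T i ≟ v ⌋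

-- We compute reachability: start from the
-- endpoints of the first edge of A and, n times, add both endpoints of
-- every edge of A having an already reached endpoint (a path in a graph
-- with n edges has at most n edges).

firstEdgeVerts : ∀ {n} → Tree n → EdgeSet n → Vec Bool (suc n)
firstEdgeVerts {n} T A = go (tabulate (λ i → i)) A
  where
  go : ∀ {m} → Vec (Fin n) m → Vec Bool m → Vec Bool (suc n)
  go []       []           = replicate _ false
  go (i ∷ is) (true  ∷ bs) = tabulate (incident T i)
  go (i ∷ is) (false ∷ bs) = go is bs

touches : ∀ {n} → Tree n → Vec Bool (suc n) → Fin n → Bool
touches T R i = lookup R (end₁ T i) ∨ lookup R (end₂ T i)

step : ∀ {n} → Tree n → EdgeSet n → Vec Bool (suc n) → Vec Bool (suc n)
step {n} T A R = tabulate λ v →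
  lookup R v ∨ anyV (tabulate λ (i : Fin n) → lookup A i ∧ touches T R i ∧ incident T i v)

iterate : ∀ {A : Set} → ℕ → (A → A) → A → A
iterate zero    f a = a
iterate (suc k) f a = iterate k f (f a)

reached : ∀ {n} → Tree n → EdgeSet n → Vec Bool (suc n)
reached {n} T A = iterate n (step T A) (firstEdgeVerts T A)

connected : ∀ {n} → Tree n → EdgeSet n → Bool
connected {n} T A =
  allV (tabulate λ (i : Fin n) → not (lookup A i) ∨ touches T (reached T A) i)

isSubtree : ∀ {n} → Tree n → EdgeSet n → Bool
isSubtree T A = nonempty A ∧ connected T A

degree : ∀ {n} → Tree n → EdgeSet n → Fin (suc n) → ℕ
degree {n} T S v = card (tabulate λ (i : Fin n) → lookup S i ∧ incident T i v)

isOne : ℕ → Bool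
isOne (suc zero) = true
isOne _          = false

leafEdges : ∀ {n} → Tree n → EdgeSet n → EdgeSet n
leafEdges {n} T S = tabulate λ (i : Fin n) →
  lookup S i ∧ (isOne (degree T S (end₁ T i)) ∨ isOne (degree T S (end₂ T i)))

-- Connector: B is the connector K(A) iff B ⊆ E ∖ A, A ∪ B is a tree,
-- and B is inclusion-minimal with this property.  (The paper notes
-- such B is unique, so summing over all such B gives exactly the term
-- for K(A).)

allL : ∀ {A : Set} → (A → Bool) → List A → Bool
allL p = List.foldr (λ a b → p a ∧ b) true

isConnector : ∀ {n} → Tree n → EdgeSet n → EdgeSet n → Bool
isConnector {n} T A B =
  disjoint A B ∧ connected T (A ∪ B) ∧
  allL (λ B′ → not (B′ ⊆ᵇ B ∧ connected T (A ∪ B′)) ∨ (B′ == B)) (allSubsets n)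

infixr 8 _^_
_^_ : ℚ → ℕ → ℚ
x ^ zero  = 1ℚ
x ^ suc k = x * (x ^ k)

sumℚ : List ℚ → ℚ
sumℚ = List.foldr _+_ 0ℚ

subtreePoly : ∀ {n} → Tree n → ℚ → ℚ → ℚ
subtreePoly {n} T q r = sumℚ (map term (allSubsets n))
  where
  term : EdgeSet n → ℚ
  term S = if isSubtree T S then (q ^ card S) * (r ^ card (leafEdges T S)) else 0ℚ

connectorPoly : ∀ {n} → Tree n → ℚ → ℚ → ℚ
connectorPoly {n} T x y =
  sumℚ (List.concatMap (λ A → map (term A) (allSubsets n)) (allSubsets n))
  where
  term : EdgeSet n → EdgeSet n → ℚ
  term A B = if nonempty A ∧ isConnector T A B then (x ^ card A) * (y ^ card B) else 0ℚ

module Submission where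

open import Defs
open import Data.Nat using (ℕ)
open import Data.Product using (_×_)
open import Relation.Binary.PropositionalEquality using (_≡_)
open import Data.Rational using (ℚ; 1ℚ; NonZero; _+_; _-_; _*_; _÷_)

-- For a subtree S and A ⊆ S, the connector of A is S ∖ A exactly when every leaf edge
-- of S lies in A: a leaf of S outside A could be dropped from S ∖ A, and a subtree of S
-- containing all leaves of S is S itself.  Grouping the terms of K_T by S = A ∪ K(A) gives
--   K_T(x,y) = Σ_S Σ_{L(S) ⊆ A ⊆ S} x^#A y^#(S∖A) = Σ_S x^#L(S) (x+y)^#(S∖L(S)),
-- and both identities are this formula after substituting x = qr, y = q(1-r), resp.
-- q = x+y, r = x/(x+y).  Since edge i joins suc i to its parent, an edge set is connected
-- iff every one of its edges hangs from a common top vertex or from another of its edges.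

import Data.Nat as ℕ
import Data.Nat.Properties as ℕ
open import Data.Bool using (Bool; true; false; _∧_; _∨_; not; if_then_else_)
open import Data.Bool.Properties using (∨-zeroʳ; if-∧; if-swap-then; if-cong; if-cong-then)
open import Data.Fin using (Fin; zero; suc; toℕ; _≤_; _<_)
open import Data.Fin.Properties using (_≟_; suc-injective; 0≢1+n)
open import Data.Fin.Induction using (<-wellFounded)
open import Data.Fin.Subset using (_∈_; _∉_; _⊆_; _⊂_; _─_; ⁅_⁆; Nonempty; ∣_∣)
open import Data.Fin.Subset.Properties
  using ( _∈?_; _⊂?_; nonempty?; drop-there; drop-∷-⊆; ∈⊤; x∈⁅x⁆; x∉⁅y⁆⇒x≢y; ∣p∣≤n
        ; ∣p∣≡n⇒p≡⊤; ⊆-antisym; p⊂q⇒∣p∣<∣q∣; x∈p∪q⁻; x∈p∪q⁺; p─q⊆p; x∈p∧x∉q⇒x∈p─q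
        ; x∈p∧x≢y⇒x∈p-y; p─q─r≡p─r─q; x∈p⇒p-x⊂p; x∈p⇒∣p-x∣<∣p∣)
open import Data.Fin.Subset.Induction using (⊂-wellFounded)
open import Data.Vec using (Vec; []; _∷_; lookup; tabulate; replicate; here; there)
open import Data.Vec.Properties using (lookup∘tabulate; []=⇒lookup; lookup⇒[]=)
open import Data.List using (List; []; _∷_; map; _++_; concatMap)
open import Data.List.Properties using (map-++; map-∘; map-cong)
open import Data.List.Membership.Propositional using () renaming (_∈_ to _∈ₗ_)
open import Data.List.Membership.Propositional.Properties using (∈-++⁺ˡ; ∈-++⁺ʳ; ∈-map⁺)
import Data.List.Relation.Unary.Any as Any
open import Data.Product using (∃; ∃-syntax; _,_; proj₁; proj₂)
open import Data.Sum using (_⊎_; inj₁; inj₂; [_,_]′)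
open import Data.Empty using (⊥-elim)
open import Data.Rational using (0ℚ; 1/_)
open import Data.Rational.Properties
  using ( +-identityˡ; +-identityʳ; +-assoc; +-comm; *-assoc; *-zeroˡ; *-zeroʳ; *-identityˡ; *-identityʳ
        ; *-inverseʳ; *-distribˡ-+; *-distribʳ-+; +-0-commutativeMonoid; *-1-commutativeMonoid; +-*-commutativeRing)
open import Data.Rational.Solver using (module +-*-Solver)
open import Algebra.Bundles using (CommutativeMonoid; CommutativeRing)
open import Algebra.Properties.CommutativeSemigroup (CommutativeMonoid.commutativeSemigroup +-0-commutativeMonoid)
  using (interchange)
open import Algebra.Properties.CommutativeSemigroup (CommutativeMonoid.commutativeSemigroup *-1-commutativeMonoid)
  using () renaming (x∙yz≈y∙xz to x*yz≡y*xz; xy∙z≈xz∙y to xy*z≡xz*y)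
open CommutativeRing +-*-commutativeRing using (commutativeSemiring; semiring)
open import Algebra.Properties.Semiring.Exp semiring
  using () renaming (_^_ to _^ₛ_; ^-homo-* to ^ₛ-homo-*)
open import Algebra.Properties.CommutativeSemiring.Exp commutativeSemiring
  using () renaming (^-distrib-* to ^ₛ-distrib-*)
open import Function using (_∘_; id)
open import Induction.WellFounded using (Acc; acc)
open import Relation.Nullary.Decidable using (yes; no; decidable-stable)
open import Relation.Binary.PropositionalEquality
  using (_≢_; refl; sym; trans; cong; cong₂; subst; subst₂; module ≡-Reasoning)

private variable X Y : Set

∧-true⁻ : ∀ {a b} → a ∧ b ≡ true → a ≡ true × b ≡ true
∧-true⁻ {true} b≡true = refl , b≡true

∧-true⁺ : ∀ {a b} → a ≡ true → b ≡ true → a ∧ b ≡ true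
∧-true⁺ refl b≡true = b≡true

∨-true⁻ : ∀ {a b} → a ∨ b ≡ true → a ≡ true ⊎ b ≡ true
∨-true⁻ {true}  _      = inj₁ refl
∨-true⁻ {false} b≡true = inj₂ b≡true

∨-true⁺ : ∀ {a b} → a ≡ true ⊎ b ≡ true → a ∨ b ≡ true
∨-true⁺     (inj₁ refl) = refl
∨-true⁺ {a} (inj₂ refl) = ∨-zeroʳ a

not-∨-true⁺ : ∀ {a b} → (a ≡ true → b ≡ true) → not a ∨ b ≡ true
not-∨-true⁺ {true}  a⇒b = a⇒b refl
not-∨-true⁺ {false} _   = refl

true-ext : ∀ {a b} → (a ≡ true → b ≡ true) → (b ≡ true → a ≡ true) → a ≡ b
true-ext {true}  {true}  _   _   = refl
true-ext {true}  {false} a⇒b _   = sym (a⇒b refl)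
true-ext {false} {true}  _   b⇒a = b⇒a refl
true-ext {false} {false} _   _   = refl

if-then-cong : ∀ b {u v w : X} → (b ≡ true → u ≡ v) → (if b then u else w) ≡ (if b then v else w)
if-then-cong true  u≡v = u≡v refl
if-then-cong false _   = refl

if-implied : ∀ {b c} {u w : X} → (c ≡ true → b ≡ true) →
             (if c then u else w) ≡ (if b then (if c then u else w) else w)
if-implied {b = true}                _   = refl
if-implied {b = false} {c = true}  c⇒b with c⇒b refl
... | ()
if-implied {b = false} {c = false} _   = refl

if-∧-false : ∀ b {u w : X} → (if b ∧ false then u else w) ≡ w
if-∧-false true  = refl
if-∧-false false = refl

if-*-assoc : ∀ b (a u v : ℚ) → (if b then (a * u) * v else 0ℚ) ≡ a * (if b then u * v else 0ℚ)
if-*-assoc true  a u v = *-assoc a u v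
if-*-assoc false a u v = sym (*-zeroʳ a)

if-*-left-comm : ∀ b (a u v : ℚ) → (if b then u * (a * v) else 0ℚ) ≡ a * (if b then u * v else 0ℚ)
if-*-left-comm true  a u v = x*yz≡y*xz u a v
if-*-left-comm false a u v = sym (*-zeroʳ a)

module _ {m : ℕ} where

  lookup⇒∈ : ∀ {S : Vec Bool m} {i} → lookup S i ≡ true → i ∈ S
  lookup⇒∈ {S} {i} = lookup⇒[]= i S

  ∈-tabulate⁻ : ∀ {f : Fin m → Bool} {i} → i ∈ tabulate f → f i ≡ true
  ∈-tabulate⁻ {f} {i} i∈ = trans (sym (lookup∘tabulate f i)) ([]=⇒lookup i∈)

  ∈-tabulate⁺ : ∀ {f : Fin m → Bool} {i} → f i ≡ true → i ∈ tabulate f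
  ∈-tabulate⁺ {f} {i} fi = lookup⇒∈ (trans (lookup∘tabulate f i) fi)

anyV⁻ : ∀ {m} (v : Vec Bool m) → anyV v ≡ true → Nonempty v
anyV⁻ (true  ∷ v) _ = zero , here
anyV⁻ (false ∷ v) h = let i , i∈v = anyV⁻ v h in suc i , there i∈v

anyV⁺ : ∀ {m} {v : Vec Bool m} {i} → i ∈ v → anyV v ≡ true
anyV⁺ here                    = refl
anyV⁺ {v = b ∷ _} (there i∈v) = ∨-true⁺ {b} (inj₂ (anyV⁺ i∈v))

allV⁻ : ∀ {m} (v : Vec Bool m) → allV v ≡ true → ∀ i → i ∈ v
allV⁻ (true ∷ v) _ zero    = here
allV⁻ (true ∷ v) h (suc i) = there (allV⁻ v h i)

allV⁺ : ∀ {m} (v : Vec Bool m) → (∀ i → i ∈ v) → allV v ≡ true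
allV⁺ []      _    = refl
allV⁺ (b ∷ v) all∈ with all∈ zero
... | here = allV⁺ v (λ i → drop-there (all∈ (suc i)))

⊆ᵇ⁻ : ∀ {m} (A B : Vec Bool m) → A ⊆ᵇ B ≡ true → A ⊆ B
⊆ᵇ⁻ (true ∷ A) (true  ∷ B) _ here        = here
⊆ᵇ⁻ (true ∷ A) (false ∷ B) () here
⊆ᵇ⁻ (a    ∷ A) (b     ∷ B) h (there i∈A) = there (⊆ᵇ⁻ A B (proj₂ (∧-true⁻ {not a ∨ b} h)) i∈A)

⊆ᵇ⁺ : ∀ {m} (A B : Vec Bool m) → A ⊆ B → A ⊆ᵇ B ≡ true
⊆ᵇ⁺ []          []      _   = refl
⊆ᵇ⁺ (true  ∷ A) (b ∷ B) A⊆B with A⊆B here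
... | here = ⊆ᵇ⁺ A B (drop-∷-⊆ A⊆B)
⊆ᵇ⁺ (false ∷ A) (b ∷ B) A⊆B = ⊆ᵇ⁺ A B (drop-∷-⊆ A⊆B)

==⁻ : ∀ {m} (A B : Vec Bool m) → A == B ≡ true → A ≡ B
==⁻ []          []          _ = refl
==⁻ (true  ∷ A) (true  ∷ B) h = cong (true ∷_) (==⁻ A B h)
==⁻ (false ∷ A) (false ∷ B) h = cong (false ∷_) (==⁻ A B h)

==-refl : ∀ {m} (A : Vec Bool m) → A == A ≡ true
==-refl []          = refl
==-refl (true  ∷ A) = ==-refl A
==-refl (false ∷ A) = ==-refl A

disjoint-─ : ∀ {m} (A S : Vec Bool m) → disjoint A (S ─ A) ≡ true
disjoint-─ []          []      = refl
disjoint-─ (true  ∷ A) (s ∷ S) = disjoint-─ A S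
disjoint-─ (false ∷ A) (s ∷ S) = disjoint-─ A S

x∈p─q⇒x∉q : ∀ {m} (p q : Vec Bool m) {x} → x ∈ p ─ q → x ∉ q
x∈p─q⇒x∉q (_ ∷ p) (false ∷ q) here       = λ ()
x∈p─q⇒x∉q (_ ∷ p) (true  ∷ q) {zero} ()
x∈p─q⇒x∉q (_ ∷ p) (_     ∷ q) (there x∈) = λ { (there x∈q) → x∈p─q⇒x∉q p q x∈ x∈q }

x∈p-y⁻ : ∀ {m} {p : Vec Bool m} {x y} → x ∈ p ─ ⁅ y ⁆ → x ∈ p × x ≢ y
x∈p-y⁻ {p = p} {y = y} x∈ = p─q⊆p p ⁅ y ⁆ x∈ , x∉⁅y⁆⇒x≢y (x∈p─q⇒x∉q p ⁅ y ⁆ x∈)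

p⊆q⇒p∪[q─p]≡q : ∀ {m} {p q : Vec Bool m} → p ⊆ q → p ∪ (q ─ p) ≡ q
p⊆q⇒p∪[q─p]≡q {p = p} {q} p⊆q = ⊆-antisym to from
  where
  to : p ∪ (q ─ p) ⊆ q
  to x∈ = [ p⊆q , p─q⊆p q p ]′ (x∈p∪q⁻ p (q ─ p) x∈)
  from : q ⊆ p ∪ (q ─ p)
  from {x} x∈q with x ∈? p
  ... | yes x∈p = x∈p∪q⁺ (inj₁ x∈p)
  ... | no x∉p  = x∈p∪q⁺ (inj₂ (x∈p∧x∉q⇒x∈p─q x∈q x∉p))

card≡0⇒∉ : ∀ {m} (v : Vec Bool m) → card v ≡ 0 → ∀ {i} → i ∉ v
card≡0⇒∉ (false ∷ v) c (there i∈v) = card≡0⇒∉ v c i∈v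

∉⇒card≡0 : ∀ {m} (v : Vec Bool m) → (∀ {i} → i ∉ v) → card v ≡ 0
∉⇒card≡0 []          _    = refl
∉⇒card≡0 (true  ∷ v) none = ⊥-elim (none here)
∉⇒card≡0 (false ∷ v) none = ∉⇒card≡0 v (none ∘ there)

card≡1⇒unique : ∀ {m} (v : Vec Bool m) → card v ≡ 1 → ∀ {i j} → i ∈ v → j ∈ v → i ≡ j
card≡1⇒unique (true  ∷ v) c here        here        = refl
card≡1⇒unique (true  ∷ v) c here        (there j∈v) = ⊥-elim (card≡0⇒∉ v (ℕ.suc-injective c) j∈v)
card≡1⇒unique (true  ∷ v) c (there i∈v) _           = ⊥-elim (card≡0⇒∉ v (ℕ.suc-injective c) i∈v)
card≡1⇒unique (false ∷ v) c (there i∈v) (there j∈v) = cong suc (card≡1⇒unique v c i∈v j∈v)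

unique⇒card≡1 : ∀ {m} (v : Vec Bool m) {i} → i ∈ v → (∀ {j} → j ∈ v → j ≡ i) → card v ≡ 1
unique⇒card≡1 (true  ∷ v) here        only =
  cong ℕ.suc (∉⇒card≡0 v (λ j∈v → 0≢1+n (sym (only (there j∈v)))))
unique⇒card≡1 (true  ∷ v) (there i∈v) only with only here
... | ()
unique⇒card≡1 (false ∷ v) (there i∈v) only = unique⇒card≡1 v i∈v (suc-injective ∘ only ∘ there)

card-─ : ∀ {m} {L S : Vec Bool m} → L ⊆ S → card S ≡ card L ℕ.+ card (S ─ L)
card-─ {L = []}        {[]}        _   = refl
card-─ {L = true  ∷ L} {s ∷ S}     L⊆S with L⊆S here
... | here = cong ℕ.suc (card-─ (drop-∷-⊆ L⊆S))
card-─ {L = false ∷ L} {true  ∷ S} L⊆S =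
  trans (cong ℕ.suc (card-─ (drop-∷-⊆ L⊆S))) (sym (ℕ.+-suc (card L) _))
card-─ {L = false ∷ L} {false ∷ S} L⊆S = card-─ (drop-∷-⊆ L⊆S)

IsMax : ∀ {m} → Vec Bool m → Fin m → Set
IsMax S M = M ∈ S × (∀ {j} → j ∈ S → j ≤ M)

max-exists : ∀ {m} (S : Vec Bool m) → Nonempty S → ∃ (IsMax S)
max-exists (b ∷ S) ne with nonempty? S
... | yes neS = let M , M∈S , ≤M = max-exists S neS in
  suc M , there M∈S , λ { here → ℕ.z≤n ; (there j∈S) → ℕ.s≤s (≤M j∈S) }
... | no ¬neS with ne
...   | zero  , 0∈        = zero , 0∈ , λ { here → ℕ.z≤n ; (there j∈S) → ⊥-elim (¬neS (_ , j∈S)) }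
...   | suc i , there i∈S = ⊥-elim (¬neS (i , i∈S))

allSubsets-complete : ∀ {m} (v : Vec Bool m) → v ∈ₗ allSubsets m
allSubsets-complete []          = Any.here refl
allSubsets-complete (true  ∷ v) = ∈-++⁺ˡ (∈-map⁺ (true ∷_) (allSubsets-complete v))
allSubsets-complete (false ∷ v) = ∈-++⁺ʳ _ (∈-map⁺ (false ∷_) (allSubsets-complete v))

allL⁻ : ∀ {p : X → Bool} {xs x} → allL p xs ≡ true → x ∈ₗ xs → p x ≡ true
allL⁻ {p = p} {y ∷ _} h (Any.here refl) = proj₁ (∧-true⁻ {p y} h)
allL⁻ {p = p} {y ∷ _} h (Any.there x∈)  = allL⁻ (proj₂ (∧-true⁻ {p y} h)) x∈

allL⁺ : ∀ {p : X → Bool} → (∀ x → p x ≡ true) → ∀ xs → allL p xs ≡ true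
allL⁺ all []       = refl
allL⁺ all (x ∷ xs) = ∧-true⁺ (all x) (allL⁺ all xs)

iterate-fixed : ∀ {f : X → X} {x} k → f x ≡ x → iterate k f x ≡ x
iterate-fixed ℕ.zero    _   = refl
iterate-fixed (ℕ.suc k) fix = trans (cong (iterate k _) fix) (iterate-fixed k fix)

iterate-⊇ : ∀ {m} {f : Vec Bool m → Vec Bool m} → (∀ {R} → R ⊆ f R) → ∀ k {R} → R ⊆ iterate k f R
iterate-⊇ inflate ℕ.zero    x∈R = x∈R
iterate-⊇ inflate (ℕ.suc k) x∈R = iterate-⊇ inflate k (inflate x∈R)

-- Each step that is not stationary adds an element, and there are only m elements.
iterate-closed : ∀ {m} (f : Vec Bool m → Vec Bool m) → (∀ {R} → R ⊆ f R) →
                 ∀ k R → m ℕ.≤ k ℕ.+ ∣ R ∣ → f (iterate k f R) ⊆ iterate k f R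
iterate-closed f inflate ℕ.zero R m≤∣R∣ {x} _ =
  subst (x ∈_) (sym (∣p∣≡n⇒p≡⊤ (ℕ.≤-antisym (∣p∣≤n R) m≤∣R∣))) ∈⊤
iterate-closed f inflate (ℕ.suc k) R bound with R ⊂? f R
... | yes R⊂fR = iterate-closed f inflate k (f R)
                   (ℕ.≤-trans bound (ℕ.≤-trans (ℕ.≤-reflexive (sym (ℕ.+-suc k ∣ R ∣)))
                                               (ℕ.+-monoʳ-≤ k (p⊂q⇒∣p∣<∣q∣ R⊂fR))))
... | no R⊄fR = subst (λ X → f X ⊆ X) (sym (trans (cong (iterate k f) fR≡R) (iterate-fixed k fR≡R))) fR⊆R
  where
  fR⊆R : f R ⊆ R
  fR⊆R {x} x∈fR = decidable-stable (x ∈? R) (λ x∉R → R⊄fR (inflate , x , x∈fR , x∉R))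
  fR≡R : f R ≡ R
  fR≡R = ⊆-antisym fR⊆R inflate

firstEdgeOf : ∀ {n m} → Tree n → Vec (Fin n) m → Vec Bool m → Vec Bool (ℕ.suc n)
firstEdgeOf T []       []           = replicate _ false
firstEdgeOf T (i ∷ is) (true  ∷ bs) = tabulate (incident T i)
firstEdgeOf T (i ∷ is) (false ∷ bs) = firstEdgeOf T is bs

firstEdgeOf-spec : ∀ {n m} (T : Tree n) (is : Vec (Fin n) m) {bs : Vec Bool m} {k} → k ∈ bs →
                   ∃[ f ] (f ∈ bs × firstEdgeOf T is bs ≡ tabulate (incident T (lookup is f)))
firstEdgeOf-spec T (i ∷ is) {true  ∷ bs} _            = zero , here , refl
firstEdgeOf-spec T (i ∷ is) {false ∷ bs} (there k∈bs) =
  let f , f∈bs , eq = firstEdgeOf-spec T is k∈bs in suc f , there f∈bs , eq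

-- firstEdgeVerts recurses through a where-bound helper that cannot be named; the
-- metavariable in the type of firstEdgeVerts-helper is solved by its use in firstEdgeVerts≡.
mutual
  firstEdgeVerts≡ : ∀ {n} (T : Tree n) (A : EdgeSet n) → firstEdgeVerts T A ≡ firstEdgeOf T (tabulate id) A
  firstEdgeVerts≡ T []          = refl
  firstEdgeVerts≡ T (true  ∷ A) = refl
  firstEdgeVerts≡ {ℕ.suc n} T (false ∷ A) with ℕ.suc n | T | false ∷ A | tabulate {n = n} suc
  ... | _ | T′ | A′ | is = firstEdgeVerts-helper T′ A′ is A

  firstEdgeVerts-helper : ∀ {n} (T : Tree n) (A : EdgeSet n) {m} (is : Vec (Fin n) m) (bs : Vec Bool m) →
                          _ ≡ firstEdgeOf T is bs
  firstEdgeVerts-helper T A []       []           = refl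
  firstEdgeVerts-helper T A (i ∷ is) (true  ∷ bs) = refl
  firstEdgeVerts-helper T A (i ∷ is) (false ∷ bs) = firstEdgeVerts-helper T A is bs

firstEdgeVerts-spec : ∀ {n} (T : Tree n) (A : EdgeSet n) → Nonempty A →
                      ∃[ f ] (f ∈ A × firstEdgeVerts T A ≡ tabulate (incident T f))
firstEdgeVerts-spec T A (k , k∈A) =
  let f , f∈A , eq = firstEdgeOf-spec T (tabulate id) k∈A in
  f , f∈A , trans (firstEdgeVerts≡ T A) (trans eq (cong (tabulate ∘ incident T) (lookup∘tabulate id f)))

module TreeEdges {n : ℕ} (T : Tree n) where

  Incident : Fin n → Fin (ℕ.suc n) → Set
  Incident i v = suc i ≡ v ⊎ parent T i ≡ v

  incident⁻ : ∀ {i v} → incident T i v ≡ true → Incident i v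
  incident⁻ {i} {v} h with suc i ≟ v | parent T i ≟ v | h
  ... | yes s≡v | _       | _ = inj₁ s≡v
  ... | no _    | yes p≡v | _ = inj₂ p≡v

  incident⁺ : ∀ {i v} → Incident i v → incident T i v ≡ true
  incident⁺ {i} {v} i-v with suc i ≟ v | parent T i ≟ v
  ... | yes _  | _      = refl
  ... | no _   | yes _  = refl
  ... | no s≢v | no p≢v = ⊥-elim ([ s≢v , p≢v ]′ i-v)

  suc≢parent : ∀ i → suc i ≢ parent T i
  suc≢parent i s≡p = ℕ.<-irrefl refl (subst (λ v → toℕ v ℕ.≤ toℕ i) (sym s≡p) (parent≤ T i))

  parent-edge< : ∀ {i j} → suc j ≡ parent T i → j < i
  parent-edge< {i} s≡p = subst (λ v → toℕ v ℕ.≤ toℕ i) (sym s≡p) (parent≤ T i)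

  RootedAt : EdgeSet n → Fin (ℕ.suc n) → Set
  RootedAt S t = ∀ {i} → i ∈ S → parent T i ≡ t ⊎ ∃[ j ] (j ∈ S × suc j ≡ parent T i)

  SoleAt : EdgeSet n → Fin (ℕ.suc n) → Fin n → Set
  SoleAt S v e = e ∈ S × Incident e v × (∀ {j} → j ∈ S → Incident j v → j ≡ e)

  Leaf : EdgeSet n → Fin n → Set
  Leaf S ℓ = ∃[ v ] SoleAt S v ℓ

  max-sole : ∀ {S M} → IsMax S M → SoleAt S (suc M) M
  max-sole {S} {M} (M∈S , ≤M) = M∈S , inj₁ refl , only
    where
    only : ∀ {j} → j ∈ S → Incident j (suc M) → j ≡ M
    only j∈S (inj₁ sj≡sM) = suc-injective sj≡sM
    only j∈S (inj₂ pj≡sM) = ⊥-elim (ℕ.<⇒≱ (parent-edge< (sym pj≡sM)) (≤M j∈S))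

  rooted-remove-sole : ∀ {S t v e} → RootedAt S t → SoleAt S v e → ∃ (RootedAt (S ─ ⁅ e ⁆))
  rooted-remove-sole {S} {t} {e = e} rooted (e∈S , inj₁ refl , only) = t , rooted′
    where
    rooted′ : RootedAt (S ─ ⁅ e ⁆) t
    rooted′ i∈ with x∈p-y⁻ i∈
    ... | i∈S , i≢e with rooted i∈S
    ...   | inj₁ pi≡t = inj₁ pi≡t
    ...   | inj₂ (j , j∈S , sj≡pi) with j ≟ e
    ...     | yes refl = ⊥-elim (i≢e (only i∈S (inj₂ (sym sj≡pi))))
    ...     | no j≢e   = inj₂ (j , x∈p∧x≢y⇒x∈p-y j∈S j≢e , sj≡pi)
  rooted-remove-sole {S} {t} {e = e} rooted (e∈S , inj₂ refl , only) = suc e , rooted′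
    where
    pe≡t : parent T e ≡ t
    pe≡t with rooted e∈S
    ... | inj₁ pe≡t = pe≡t
    ... | inj₂ (j , j∈S , sj≡pe) with only j∈S (inj₁ sj≡pe)
    ...   | refl = ⊥-elim (suc≢parent e sj≡pe)
    rooted′ : RootedAt (S ─ ⁅ e ⁆) (suc e)
    rooted′ i∈ with x∈p-y⁻ i∈
    ... | i∈S , i≢e with rooted i∈S
    ...   | inj₁ pi≡t = ⊥-elim (i≢e (only i∈S (inj₂ (trans pi≡t (sym pe≡t)))))
    ...   | inj₂ (j , j∈S , sj≡pi) with j ≟ e
    ...     | yes refl = inj₁ (sym sj≡pi)
    ...     | no j≢e   = inj₂ (j , x∈p∧x≢y⇒x∈p-y j∈S j≢e , sj≡pi)

  sole-lift : ∀ {S M w ℓ} → IsMax S M → SoleAt (S ─ ⁅ M ⁆) w ℓ → w ≢ parent T M → SoleAt S w ℓ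
  sole-lift {S} {M} {w} {ℓ} maxS (ℓ∈ , ℓ-w , only) w≢pM = proj₁ (x∈p-y⁻ ℓ∈) , ℓ-w , only′
    where
    only′ : ∀ {j} → j ∈ S → Incident j w → j ≡ ℓ
    only′ {j} j∈S j-w with j ≟ M
    ... | no j≢M = only (x∈p∧x≢y⇒x∈p-y j∈S j≢M) j-w
    ... | yes refl with j-w
    ...   | inj₂ pM≡w = ⊥-elim (w≢pM (sym pM≡w))
    ...   | inj₁ refl with x∈p-y⁻ ℓ∈
    ...     | ℓ∈S , ℓ≢M = ⊥-elim (ℓ≢M (proj₂ (proj₂ (max-sole maxS)) ℓ∈S ℓ-w))

  -- No connectivity is needed: an edge set of a tree is a forest, and a forest with two
  -- edges has two leaves.
  another-leaf : ∀ {S M j} → Acc _⊂_ S → IsMax S M → j ∈ S → j ≢ M → ∃[ ℓ ] (Leaf S ℓ × ℓ ≢ M)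
  another-leaf {S} {M} {j} (acc rs) maxS j∈S j≢M with max-exists (S ─ ⁅ M ⁆) (j , x∈p∧x≢y⇒x∈p-y j∈S j≢M)
  ... | M′ , maxS′@(M′∈S′ , _) with parent T M ≟ suc M′
  ...   | no pM≢sM′ =
    M′ , (suc M′ , sole-lift maxS (max-sole maxS′) (pM≢sM′ ∘ sym)) , proj₂ (x∈p-y⁻ M′∈S′)
  ...   | yes pM≡sM′ with nonempty? (S ─ ⁅ M ⁆ ─ ⁅ M′ ⁆)
  ...     | no S′-is-M′ = M′ , (parent T M′ , sole-lift maxS sole pM′≢pM) , proj₂ (x∈p-y⁻ M′∈S′)
    where
    sole : SoleAt (S ─ ⁅ M ⁆) (parent T M′) M′
    sole = M′∈S′ , inj₂ refl , λ {i} i∈S′ _ →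
      decidable-stable (i ≟ M′) (λ i≢M′ → S′-is-M′ (i , x∈p∧x≢y⇒x∈p-y i∈S′ i≢M′))
    pM′≢pM : parent T M′ ≢ parent T M
    pM′≢pM pM′≡pM = suc≢parent M′ (trans (sym pM≡sM′) (sym pM′≡pM))
  ...     | yes (j′ , j′∈) with x∈p-y⁻ j′∈
  ...       | j′∈S′ , j′≢M′ with another-leaf (rs (x∈p⇒p-x⊂p (proj₁ maxS))) maxS′ j′∈S′ j′≢M′
  ...         | ℓ , (w , sole@(ℓ∈S′ , _ , only)) , ℓ≢M′ with w ≟ parent T M
  ...           | no w≢pM = ℓ , (w , sole-lift maxS sole w≢pM) , proj₂ (x∈p-y⁻ ℓ∈S′)
  ...           | yes refl = ⊥-elim (ℓ≢M′ (sym (only M′∈S′ (inj₁ (sym pM≡sM′)))))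

  max-neighbour : ∀ {C t M c} → RootedAt C t → IsMax C M → c ∈ C → c ≢ M →
                  ∃[ c′ ] (c′ ∈ C × c′ ≢ M × Incident c′ (parent T M))
  max-neighbour {C} {t} {M} {c} rooted (M∈C , ≤M) c∈C c≢M with rooted M∈C
  ... | inj₂ (j , j∈C , sj≡pM) = j , j∈C , (λ { refl → suc≢parent M sj≡pM }) , inj₁ sj≡pM
  ... | inj₁ pM≡t = climb (<-wellFounded c) c∈C c≢M
    where
    climb : ∀ {i} → Acc _<_ i → i ∈ C → i ≢ M → ∃[ c′ ] (c′ ∈ C × c′ ≢ M × Incident c′ (parent T M))
    climb {i} (acc rs) i∈C i≢M with rooted i∈C
    ... | inj₁ pi≡t = i , i∈C , i≢M , inj₂ (trans pi≡t (sym pM≡t))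
    ... | inj₂ (j , j∈C , sj≡pi) = climb (rs j<i) j∈C (λ { refl → ℕ.<⇒≱ j<i (≤M i∈C) })
      where
      j<i : j < i
      j<i = parent-edge< sj≡pi

  -- Induction on S: its largest edge M is a leaf of S and of C, and removing it keeps
  -- both rooted; a new leaf of S ─ ⁅ M ⁆ at parent M is the edge of C next to M.
  leaves-span : ∀ {S C s c} → Acc _⊂_ S → C ⊆ S → RootedAt S s → RootedAt C c → Nonempty C →
                (∀ {ℓ} → Leaf S ℓ → ℓ ∈ C) → S ⊆ C
  leaves-span {S} {C} (acc rs) C⊆S rootedS rootedC (k , k∈C) leaves⊆C {i} i∈S with max-exists S (k , C⊆S k∈C)
  ... | M , maxS@(M∈S , ≤M) with i ≟ M
  ...   | yes refl = leaves⊆C (_ , max-sole maxS)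
  ...   | no i≢M with another-leaf (acc rs) maxS i∈S i≢M
  ...     | ℓ₀ , leaf₀ , ℓ₀≢M = p─q⊆p C ⁅ M ⁆ (S′⊆C′ (x∈p∧x≢y⇒x∈p-y i∈S i≢M))
    where
    maxC : IsMax C M
    maxC = leaves⊆C (_ , max-sole maxS) , ≤M ∘ C⊆S
    ℓ₀∈C : ℓ₀ ∈ C
    ℓ₀∈C = leaves⊆C leaf₀
    C′⊆S′ : C ─ ⁅ M ⁆ ⊆ S ─ ⁅ M ⁆
    C′⊆S′ j∈ = let j∈C , j≢M = x∈p-y⁻ j∈ in x∈p∧x≢y⇒x∈p-y (C⊆S j∈C) j≢M
    leaves′ : ∀ {ℓ} → Leaf (S ─ ⁅ M ⁆) ℓ → ℓ ∈ C ─ ⁅ M ⁆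
    leaves′ {ℓ} (w , sole@(ℓ∈S′ , _ , only)) with w ≟ parent T M
    ... | no w≢pM = x∈p∧x≢y⇒x∈p-y (leaves⊆C (w , sole-lift maxS sole w≢pM)) (proj₂ (x∈p-y⁻ ℓ∈S′))
    ... | yes refl with max-neighbour rootedC maxC ℓ₀∈C ℓ₀≢M
    ...   | c′ , c′∈C , c′≢M , c′-pM =
      subst (_∈ C ─ ⁅ M ⁆) (only (x∈p∧x≢y⇒x∈p-y (C⊆S c′∈C) c′≢M) c′-pM)
            (x∈p∧x≢y⇒x∈p-y c′∈C c′≢M)
    S′⊆C′ : S ─ ⁅ M ⁆ ⊆ C ─ ⁅ M ⁆
    S′⊆C′ = leaves-span (rs (x∈p⇒p-x⊂p M∈S)) C′⊆S′
              (proj₂ (rooted-remove-sole rootedS (max-sole maxS)))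
              (proj₂ (rooted-remove-sole rootedC (max-sole maxC)))
              (ℓ₀ , x∈p∧x≢y⇒x∈p-y ℓ₀∈C ℓ₀≢M) leaves′

  edgesAt⁻ : ∀ {S v j} → j ∈ tabulate (λ i → lookup S i ∧ incident T i v) → j ∈ S × Incident j v
  edgesAt⁻ j∈ = let j∈S , j-v = ∧-true⁻ (∈-tabulate⁻ j∈) in lookup⇒∈ j∈S , incident⁻ j-v

  edgesAt⁺ : ∀ {S v j} → j ∈ S → Incident j v → j ∈ tabulate (λ i → lookup S i ∧ incident T i v)
  edgesAt⁺ j∈S j-v = ∈-tabulate⁺ (∧-true⁺ ([]=⇒lookup j∈S) (incident⁺ j-v))

  degree-one⁻ : ∀ {S v ℓ} → isOne (degree T S v) ≡ true → ℓ ∈ S → Incident ℓ v → SoleAt S v ℓ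
  degree-one⁻ {S} {v} one ℓ∈S ℓ-v = ℓ∈S , ℓ-v , λ j∈S j-v →
    card≡1⇒unique _ (isOne⁻ (degree T S v) one) (edgesAt⁺ j∈S j-v) (edgesAt⁺ ℓ∈S ℓ-v)
    where
    isOne⁻ : ∀ k → isOne k ≡ true → k ≡ 1
    isOne⁻ 1 _ = refl

  degree-one⁺ : ∀ {S v ℓ} → SoleAt S v ℓ → isOne (degree T S v) ≡ true
  degree-one⁺ {S} (ℓ∈S , ℓ-v , only) = subst (λ k → isOne k ≡ true)
    (sym (unique⇒card≡1 _ (edgesAt⁺ ℓ∈S ℓ-v) (λ j∈ → let j∈S , j-v = edgesAt⁻ {S} j∈ in only j∈S j-v)))
    refl

  leafEdges⁻ : ∀ {S ℓ} → ℓ ∈ leafEdges T S → Leaf S ℓ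
  leafEdges⁻ ℓ∈ with ∧-true⁻ (∈-tabulate⁻ ℓ∈)
  ... | ℓ∈S , one with ∨-true⁻ one
  ...   | inj₁ one-below = _ , degree-one⁻ one-below (lookup⇒∈ ℓ∈S) (inj₁ refl)
  ...   | inj₂ one-above = _ , degree-one⁻ one-above (lookup⇒∈ ℓ∈S) (inj₂ refl)

  leafEdges⁺ : ∀ {S ℓ} → Leaf S ℓ → ℓ ∈ leafEdges T S
  leafEdges⁺ (_ , sole@(ℓ∈S , inj₁ refl , _)) =
    ∈-tabulate⁺ (∧-true⁺ ([]=⇒lookup ℓ∈S) (∨-true⁺ (inj₁ (degree-one⁺ sole))))
  leafEdges⁺ (_ , sole@(ℓ∈S , inj₂ refl , _)) =
    ∈-tabulate⁺ (∧-true⁺ ([]=⇒lookup ℓ∈S) (∨-true⁺ (inj₂ (degree-one⁺ sole))))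

  leafEdges⊆ : ∀ {S} → leafEdges T S ⊆ S
  leafEdges⊆ ℓ∈ = proj₁ (proj₂ (leafEdges⁻ ℓ∈))

  Connected : EdgeSet n → Set
  Connected S = connected T S ≡ true

  module Reachability (A : EdgeSet n) where

    Touches : Vec Bool (ℕ.suc n) → Fin n → Set
    Touches R i = suc i ∈ R ⊎ parent T i ∈ R

    touches⁻ : ∀ {R i} → touches T R i ≡ true → Touches R i
    touches⁻ t with ∨-true⁻ t
    ... | inj₁ s∈R = inj₁ (lookup⇒∈ s∈R)
    ... | inj₂ p∈R = inj₂ (lookup⇒∈ p∈R)

    touches⁺ : ∀ {R i} → Touches R i → touches T R i ≡ true
    touches⁺ (inj₁ s∈R) = ∨-true⁺ (inj₁ ([]=⇒lookup s∈R))
    touches⁺ (inj₂ p∈R) = ∨-true⁺ (inj₂ ([]=⇒lookup p∈R))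

    -- the body of step, named so that membership in step T A R can be unfolded
    joinsVia : Vec Bool (ℕ.suc n) → Fin (ℕ.suc n) → Fin n → Bool
    joinsVia R v i = lookup A i ∧ touches T R i ∧ incident T i v

    joins : Vec Bool (ℕ.suc n) → Fin (ℕ.suc n) → Bool
    joins R v = lookup R v ∨ anyV (tabulate (joinsVia R v))

    step-⊇ : ∀ {R} → R ⊆ step T A R
    step-⊇ {R} v∈R = ∈-tabulate⁺ {f = joins R} (∨-true⁺ (inj₁ ([]=⇒lookup v∈R)))

    step-extends : ∀ {R i v} → i ∈ A → Touches R i → Incident i v → v ∈ step T A R
    step-extends {R} {v = v} i∈A i-R i-v =
      ∈-tabulate⁺ {f = joins R} (∨-true⁺ {lookup R v} (inj₂ (anyV⁺ (∈-tabulate⁺ {f = joinsVia R v}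
        (∧-true⁺ ([]=⇒lookup i∈A) (∧-true⁺ (touches⁺ i-R) (incident⁺ i-v)))))))

    step⁻ : ∀ {R v} → v ∈ step T A R →
            v ∈ R ⊎ ∃[ i ] (i ∈ A × suc i ≡ v × parent T i ∈ R)
                  ⊎ ∃[ i ] (i ∈ A × parent T i ≡ v × suc i ∈ R)
    step⁻ {R} {v} v∈ with ∨-true⁻ {lookup R v} (∈-tabulate⁻ {f = joins R} v∈)
    ... | inj₁ v∈R = inj₁ (lookup⇒∈ v∈R)
    ... | inj₂ some with anyV⁻ _ some
    ...   | i , i∈ with ∧-true⁻ (∈-tabulate⁻ i∈)
    ...     | i∈A , rest with ∧-true⁻ rest
    ...       | i-R , i-v with touches⁻ {R} {i} i-R | incident⁻ {i} {v} i-v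
    ...         | inj₁ s∈R | inj₁ refl = inj₁ s∈R
    ...         | inj₂ p∈R | inj₁ s≡v  = inj₂ (inj₁ (i , lookup⇒∈ i∈A , s≡v , p∈R))
    ...         | inj₁ s∈R | inj₂ p≡v  = inj₂ (inj₂ (i , lookup⇒∈ i∈A , p≡v , s∈R))
    ...         | inj₂ p∈R | inj₂ refl = inj₁ p∈R

    Closed : Vec Bool (ℕ.suc n) → Set
    Closed R = ∀ {i} → i ∈ A → Touches R i → suc i ∈ R × parent T i ∈ R

    reached-closed : Nonempty A → Closed (reached T A)
    reached-closed neA i∈A i-R =
      closed (step-extends i∈A i-R (inj₁ refl)) , closed (step-extends i∈A i-R (inj₂ refl))
      where
      f : Fin n
      f = proj₁ (firstEdgeVerts-spec T A neA)
      sf∈seed : suc f ∈ firstEdgeVerts T A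
      sf∈seed = subst (suc f ∈_) (sym (proj₂ (proj₂ (firstEdgeVerts-spec T A neA))))
                      (∈-tabulate⁺ {f = incident T f} (incident⁺ (inj₁ refl)))
      closed : step T A (reached T A) ⊆ reached T A
      closed = iterate-closed (step T A) step-⊇ n (firstEdgeVerts T A)
                 (ℕ.≤-trans (ℕ.≤-reflexive (ℕ.+-comm 1 n))
                            (ℕ.+-monoʳ-≤ n (ℕ.≤-trans (ℕ.s≤s ℕ.z≤n) (x∈p⇒∣p-x∣<∣p∣ sf∈seed))))

    connected⁻ : Connected A → ∀ {i} → i ∈ A → Touches (reached T A) i
    connected⁻ conn {i} i∈A = touches⁻
      (subst (λ a → not a ∨ touches T (reached T A) i ≡ true) ([]=⇒lookup i∈A)
      (∈-tabulate⁻ {f = λ i → not (lookup A i) ∨ touches T (reached T A) i} (allV⁻ _ conn i)))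

    rooted⇒connected : ∀ {t} → Nonempty A → RootedAt A t → Connected A
    rooted⇒connected {t} neA rooted with firstEdgeVerts-spec T A neA
    ... | f , f∈A , seed≡ =
      allV⁺ _ λ i → ∈-tabulate⁺ (not-∨-true⁺ λ i∈A →
        touches⁺ (inj₂ (parent∈R (<-wellFounded i) (lookup⇒∈ i∈A))))
      where
      R : Vec Bool (ℕ.suc n)
      R = reached T A
      closed : Closed R
      closed = reached-closed neA
      pf∈R : parent T f ∈ R
      pf∈R = iterate-⊇ step-⊇ n
        (subst (parent T f ∈_) (sym seed≡) (∈-tabulate⁺ {f = incident T f} (incident⁺ (inj₂ refl))))
      climb : ∀ {i} → Acc _<_ i → i ∈ A → parent T i ∈ R → t ∈ R
      climb (acc rs) i∈A pi∈R with rooted i∈A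
      ... | inj₁ pi≡t = subst (_∈ R) pi≡t pi∈R
      ... | inj₂ (j , j∈A , sj≡pi) =
        climb (rs (parent-edge< sj≡pi)) j∈A (proj₂ (closed j∈A (inj₁ (subst (_∈ R) (sym sj≡pi) pi∈R))))
      parent∈R : ∀ {i} → Acc _<_ i → i ∈ A → parent T i ∈ R
      parent∈R (acc rs) i∈A with rooted i∈A
      ... | inj₁ pi≡t = subst (_∈ R) (sym pi≡t) (climb (<-wellFounded f) f∈A pf∈R)
      ... | inj₂ (j , j∈A , sj≡pi) =
        subst (_∈ R) sj≡pi (proj₁ (closed j∈A (inj₂ (parent∈R (rs (parent-edge< sj≡pi)) j∈A))))

    Hanging : Vec Bool (ℕ.suc n) → Fin (ℕ.suc n) → Set
    Hanging R t = t ∈ R × (∀ {v} → v ∈ R → v ≡ t ⊎ ∃[ j ] (j ∈ A × suc j ≡ v × parent T j ∈ R))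

    hanging-seed : ∀ {f} → f ∈ A → Hanging (tabulate (incident T f)) (parent T f)
    hanging-seed {f} f∈A = pf∈ , λ v∈ → hang (incident⁻ (∈-tabulate⁻ {f = incident T f} v∈))
      where
      pf∈ : parent T f ∈ tabulate (incident T f)
      pf∈ = ∈-tabulate⁺ {f = incident T f} (incident⁺ (inj₂ refl))
      hang : ∀ {v} → Incident f v →
             v ≡ parent T f ⊎ ∃[ j ] (j ∈ A × suc j ≡ v × parent T j ∈ tabulate (incident T f))
      hang (inj₁ sf≡v) = inj₂ (f , f∈A , sf≡v , pf∈)
      hang (inj₂ pf≡v) = inj₁ (sym pf≡v)

    -- The top moves up along the edge of A below it, if there is one.
    next-top : ∀ {R t} → t ∈ R → ∃[ t′ ] ( t′ ∈ step T A R
                                         × (t ≡ t′ ⊎ ∃[ j ] (j ∈ A × suc j ≡ t × parent T j ∈ step T A R))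
                                         × (∀ {k} → k ∈ A → suc k ≡ t → parent T k ≡ t′))
    next-top {R} {zero}  t∈R = zero , step-⊇ t∈R , inj₁ refl , λ _ ()
    next-top {R} {suc k} t∈R with k ∈? A
    ... | yes k∈A = parent T k , pk∈ , inj₂ (k , k∈A , refl , pk∈) , λ { _ refl → refl }
      where
      pk∈ : parent T k ∈ step T A R
      pk∈ = step-extends k∈A (inj₁ t∈R) (inj₂ refl)
    ... | no k∉A = suc k , step-⊇ t∈R , inj₁ refl , λ { k∈A refl → ⊥-elim (k∉A k∈A) }

    hanging-step : ∀ {R t} → Hanging R t → ∃ (Hanging (step T A R))
    hanging-step {R} {t} (t∈R , hang) with next-top t∈R
    ... | t′ , t′∈ , t-t′ , below-t = t′ , t′∈ , hang′
      where
      old : ∀ {v} → v ∈ R → v ≡ t′ ⊎ ∃[ j ] (j ∈ A × suc j ≡ v × parent T j ∈ step T A R)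
      old v∈R with hang v∈R
      ... | inj₁ refl                    = t-t′
      ... | inj₂ (j , j∈A , sj≡v , pj∈R) = inj₂ (j , j∈A , sj≡v , step-⊇ pj∈R)
      hang′ : ∀ {v} → v ∈ step T A R → v ≡ t′ ⊎ ∃[ j ] (j ∈ A × suc j ≡ v × parent T j ∈ step T A R)
      hang′ v∈ with step⁻ v∈
      ... | inj₁ v∈R                             = old v∈R
      ... | inj₂ (inj₁ (i , i∈A , si≡v , pi∈R)) = inj₂ (i , i∈A , si≡v , step-⊇ pi∈R)
      ... | inj₂ (inj₂ (i , i∈A , refl , si∈R)) with hang si∈R
      ...   | inj₁ si≡t                   = inj₁ (below-t i∈A si≡t)
      ...   | inj₂ (j , _ , sj≡si , pj∈R) = old (subst (λ j → parent T j ∈ R) (suc-injective sj≡si) pj∈R)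

    hanging-iterate : ∀ k {R t} → Hanging R t → ∃ (Hanging (iterate k (step T A) R))
    hanging-iterate ℕ.zero    hang = _ , hang
    hanging-iterate (ℕ.suc k) hang = hanging-iterate k (proj₂ (hanging-step hang))

    connected⇒rooted : Nonempty A → Connected A → ∃ (RootedAt A)
    connected⇒rooted neA conn with firstEdgeVerts-spec T A neA
    ... | f , f∈A , seed≡
      with hanging-iterate n (subst (λ R → Hanging R (parent T f)) (sym seed≡) (hanging-seed f∈A))
    ...   | t , _ , hang = t , λ i∈A → rooted (proj₂ (reached-closed neA i∈A (connected⁻ conn i∈A)))
      where
      rooted : ∀ {i} → parent T i ∈ reached T A → parent T i ≡ t ⊎ ∃[ j ] (j ∈ A × suc j ≡ parent T i)
      rooted pi∈ with hang pi∈
      ... | inj₁ pi≡t                  = inj₁ pi≡t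
      ... | inj₂ (j , j∈A , sj≡pi , _) = inj₂ (j , j∈A , sj≡pi)

  open Reachability public using (rooted⇒connected; connected⇒rooted)

  Minimal : EdgeSet n → EdgeSet n → Set
  Minimal A B = ∀ B′ → B′ ⊆ B → Connected (A ∪ B′) → B′ ≡ B

  isConnector⁻ : ∀ {A B} → isConnector T A B ≡ true → Connected (A ∪ B) × Minimal A B
  isConnector⁻ {A} {B} h with ∧-true⁻ (proj₂ (∧-true⁻ {disjoint A B} h))
  ... | conn , minimal = conn , λ B′ B′⊆B connB′ → ==⁻ B′ B
    (subst₂ (λ a b → not (a ∧ b) ∨ (B′ == B) ≡ true) (⊆ᵇ⁺ B′ B B′⊆B) connB′
            (allL⁻ minimal (allSubsets-complete B′)))

  isConnector⁺ : ∀ {A B} → disjoint A B ≡ true → Connected (A ∪ B) → Minimal A B → isConnector T A B ≡ true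
  isConnector⁺ {A} {B} disj conn minimal = ∧-true⁺ disj (∧-true⁺ conn (allL⁺ (λ B′ → not-∨-true⁺ λ h →
    let B′⊆ᵇB , connB′ = ∧-true⁻ {B′ ⊆ᵇ B} h in
    subst (λ X → B′ == X ≡ true) (minimal B′ (⊆ᵇ⁻ B′ B B′⊆ᵇB) connB′) (==-refl B′)) (allSubsets n)))

  leaves⊆⇒nonempty : ∀ {S A} → Nonempty S → leafEdges T S ⊆ A → Nonempty A
  leaves⊆⇒nonempty {S} neS L⊆A = let M , maxS = max-exists S neS in M , L⊆A (leafEdges⁺ (_ , max-sole maxS))

  -- A leaf ℓ of S outside A could be dropped: A ∪ (S ─ A ─ ⁅ ℓ ⁆) = S ─ ⁅ ℓ ⁆ is still connected.
  complement-minimal⇒leaves⊆ : ∀ {A S} → A ⊆ S → Nonempty A → Connected S → Minimal A (S ─ A) →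
                               leafEdges T S ⊆ A
  complement-minimal⇒leaves⊆ {A} {S} A⊆S (k , k∈A) connS minimal {ℓ} ℓ∈L with ℓ ∈? A
  ... | yes ℓ∈A = ℓ∈A
  ... | no ℓ∉A  = ⊥-elim (x∈p─q⇒x∉q (S ─ A) ⁅ ℓ ⁆ ℓ∈B′ (x∈⁅x⁆ ℓ))
    where
    B′ : EdgeSet n
    B′ = S ─ A ─ ⁅ ℓ ⁆
    A⊆S′ : A ⊆ S ─ ⁅ ℓ ⁆
    A⊆S′ i∈A = x∈p∧x≢y⇒x∈p-y (A⊆S i∈A) λ { refl → ℓ∉A i∈A }
    rootedS′ : ∃ (RootedAt (S ─ ⁅ ℓ ⁆))
    rootedS′ = rooted-remove-sole (proj₂ (connected⇒rooted S (k , A⊆S k∈A) connS)) (proj₂ (leafEdges⁻ ℓ∈L))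
    connB′ : Connected (A ∪ B′)
    connB′ = subst Connected
               (sym (trans (cong (A ∪_) (p─q─r≡p─r─q S A ⁅ ℓ ⁆)) (p⊆q⇒p∪[q─p]≡q A⊆S′)))
                   (rooted⇒connected (S ─ ⁅ ℓ ⁆) (k , A⊆S′ k∈A) (proj₂ rootedS′))
    ℓ∈B′ : ℓ ∈ B′
    ℓ∈B′ = subst (ℓ ∈_) (sym (minimal B′ (p─q⊆p _ _) connB′))
                 (x∈p∧x∉q⇒x∈p─q (leafEdges⊆ ℓ∈L) ℓ∉A)

  leaves⊆⇒complement-minimal : ∀ {A S} → A ⊆ S → Nonempty S → Connected S → leafEdges T S ⊆ A →
                               Minimal A (S ─ A)
  leaves⊆⇒complement-minimal {A} {S} A⊆S neS connS L⊆A B′ B′⊆B connC = ⊆-antisym B′⊆B B⊆B′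
    where
    C⊆S : A ∪ B′ ⊆ S
    C⊆S i∈C = [ A⊆S , p─q⊆p S A ∘ B′⊆B ]′ (x∈p∪q⁻ A B′ i∈C)
    neC : Nonempty (A ∪ B′)
    neC = let M , M∈A = leaves⊆⇒nonempty neS L⊆A in M , x∈p∪q⁺ (inj₁ M∈A)
    S⊆C : S ⊆ A ∪ B′
    S⊆C = leaves-span (⊂-wellFounded S) C⊆S (proj₂ (connected⇒rooted S neS connS))
                      (proj₂ (connected⇒rooted (A ∪ B′) neC connC)) neC
                      (λ leaf → x∈p∪q⁺ (inj₁ (L⊆A (leafEdges⁺ leaf))))
    B⊆B′ : S ─ A ⊆ B′
    B⊆B′ i∈ = [ ⊥-elim ∘ x∈p─q⇒x∉q S A i∈ , id ]′ (x∈p∪q⁻ A B′ (S⊆C (p─q⊆p S A i∈)))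

  connector-complement : ∀ {A S} → A ⊆ S →
                         nonempty A ∧ isConnector T A (S ─ A) ≡ isSubtree T S ∧ (leafEdges T S ⊆ᵇ A)
  connector-complement {A} {S} A⊆S = true-ext to from
    where
    to : nonempty A ∧ isConnector T A (S ─ A) ≡ true → isSubtree T S ∧ (leafEdges T S ⊆ᵇ A) ≡ true
    to h with ∧-true⁻ h
    ... | neA , isConn with anyV⁻ A neA | isConnector⁻ {A} {S ─ A} isConn
    ...   | k , k∈A | conn , minimal = ∧-true⁺ (∧-true⁺ (anyV⁺ (A⊆S k∈A)) connS)
                                               (⊆ᵇ⁺ _ _ (complement-minimal⇒leaves⊆ A⊆S (k , k∈A) connS minimal))
      where
      connS : Connected S
      connS = subst Connected (p⊆q⇒p∪[q─p]≡q A⊆S) conn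
    from : isSubtree T S ∧ (leafEdges T S ⊆ᵇ A) ≡ true → nonempty A ∧ isConnector T A (S ─ A) ≡ true
    from h with ∧-true⁻ h
    ... | subtree , L⊆ᵇA with ∧-true⁻ subtree | ⊆ᵇ⁻ _ _ L⊆ᵇA
    ...   | neS , connS | L⊆A = ∧-true⁺ (anyV⁺ (proj₂ (leaves⊆⇒nonempty (anyV⁻ S neS) L⊆A)))
                                  (isConnector⁺ {A} {S ─ A} (disjoint-─ A S)
                                     (subst Connected (sym (p⊆q⇒p∪[q─p]≡q A⊆S)) connS)
                                     (leaves⊆⇒complement-minimal A⊆S (anyV⁻ S neS) connS L⊆A))

sumℚ-++ : ∀ xs ys → sumℚ (xs ++ ys) ≡ sumℚ xs + sumℚ ys
sumℚ-++ []       ys = sym (+-identityˡ (sumℚ ys))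
sumℚ-++ (x ∷ xs) ys = trans (cong (x +_) (sumℚ-++ xs ys)) (sym (+-assoc x (sumℚ xs) (sumℚ ys)))

∑ : List X → (X → ℚ) → ℚ
∑ xs f = sumℚ (map f xs)

∑-cong : ∀ {f g : X → ℚ} → (∀ x → f x ≡ g x) → ∀ xs → ∑ xs f ≡ ∑ xs g
∑-cong f≗g xs = cong sumℚ (map-cong f≗g xs)

∑-zero : ∀ (xs : List X) → ∑ xs (λ _ → 0ℚ) ≡ 0ℚ
∑-zero []       = refl
∑-zero (x ∷ xs) = trans (cong (0ℚ +_) (∑-zero xs)) (+-identityˡ 0ℚ)

∑-+ : ∀ (f g : X → ℚ) xs → ∑ xs (λ x → f x + g x) ≡ ∑ xs f + ∑ xs g
∑-+ f g []       = sym (+-identityˡ 0ℚ)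
∑-+ f g (x ∷ xs) = trans (cong (f x + g x +_) (∑-+ f g xs)) (interchange (f x) (g x) _ _)

∑-*ˡ : ∀ c (f : X → ℚ) xs → ∑ xs (λ x → c * f x) ≡ c * ∑ xs f
∑-*ˡ c f []       = sym (*-zeroʳ c)
∑-*ˡ c f (x ∷ xs) = trans (cong (c * f x +_) (∑-*ˡ c f xs)) (sym (*-distribˡ-+ c (f x) _))

∑-if : ∀ b (f : X → ℚ) xs → ∑ xs (λ x → if b then f x else 0ℚ) ≡ (if b then ∑ xs f else 0ℚ)
∑-if true  f xs = refl
∑-if false f xs = ∑-zero xs

∑-++ : ∀ (f : X → ℚ) xs ys → ∑ (xs ++ ys) f ≡ ∑ xs f + ∑ ys f
∑-++ f xs ys = trans (cong sumℚ (map-++ f xs ys)) (sumℚ-++ (map f xs) (map f ys))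

∑-map : ∀ (f : X → ℚ) (g : Y → X) ys → ∑ (map g ys) f ≡ ∑ ys (f ∘ g)
∑-map f g ys = cong sumℚ (sym (map-∘ {g = f} {f = g} ys))

∑-comm : ∀ (f : X → Y → ℚ) xs ys → ∑ xs (λ x → ∑ ys (f x)) ≡ ∑ ys (λ y → ∑ xs (λ x → f x y))
∑-comm f []       ys = sym (∑-zero ys)
∑-comm f (x ∷ xs) ys =
  trans (cong (∑ ys (f x) +_) (∑-comm f xs ys)) (sym (∑-+ (f x) (λ y → ∑ xs (λ x → f x y)) ys))

sumℚ-concatMap : ∀ (g : X → List ℚ) xs → sumℚ (concatMap g xs) ≡ ∑ xs (sumℚ ∘ g)
sumℚ-concatMap g []       = refl
sumℚ-concatMap g (x ∷ xs) = trans (sumℚ-++ (g x) (concatMap g xs)) (cong (sumℚ (g x) +_) (sumℚ-concatMap g xs))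

∑-allSubsets-suc : ∀ m (f : Vec Bool (ℕ.suc m) → ℚ) →
                   ∑ (allSubsets (ℕ.suc m)) f
                     ≡ ∑ (allSubsets m) (f ∘ (true ∷_)) + ∑ (allSubsets m) (f ∘ (false ∷_))
∑-allSubsets-suc m f = trans (∑-++ f (map (true ∷_) (allSubsets m)) _)
                             (cong₂ _+_ (∑-map f (true ∷_) (allSubsets m)) (∑-map f (false ∷_) (allSubsets m)))

∑-allSubsets-factor : ∀ {m} α β (f : Vec Bool (ℕ.suc m) → ℚ) (g : Vec Bool m → ℚ) →
                      (∀ A → f (true ∷ A) ≡ α * g A) → (∀ A → f (false ∷ A) ≡ β * g A) →
                      ∑ (allSubsets (ℕ.suc m)) f ≡ (α + β) * ∑ (allSubsets m) g
∑-allSubsets-factor {m} α β f g f-true f-false = begin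
  ∑ (allSubsets (ℕ.suc m)) f
    ≡⟨ ∑-allSubsets-suc m f ⟩
  ∑ (allSubsets m) (f ∘ (true ∷_)) + ∑ (allSubsets m) (f ∘ (false ∷_))
    ≡⟨ cong₂ _+_ (∑-cong f-true (allSubsets m)) (∑-cong f-false (allSubsets m)) ⟩
  ∑ (allSubsets m) (λ A → α * g A) + ∑ (allSubsets m) (λ A → β * g A)
    ≡⟨ cong₂ _+_ (∑-*ˡ α g (allSubsets m)) (∑-*ˡ β g (allSubsets m)) ⟩
  α * ∑ (allSubsets m) g + β * ∑ (allSubsets m) g
    ≡⟨ *-distribʳ-+ _ α β ⟨
  (α + β) * ∑ (allSubsets m) g ∎
  where open ≡-Reasoning

∑-disjoint-reindex : ∀ {m} (A : Vec Bool m) (h : Vec Bool m → ℚ) →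
    ∑ (allSubsets m) (λ B → if disjoint A B then h B else 0ℚ)
  ≡ ∑ (allSubsets m) (λ S → if A ⊆ᵇ S then h (S ─ A) else 0ℚ)
∑-disjoint-reindex []                   h = refl
∑-disjoint-reindex {ℕ.suc m} (true ∷ A) h = begin
  ∑ (allSubsets (ℕ.suc m)) (λ B → if disjoint (true ∷ A) B then h B else 0ℚ)
    ≡⟨ ∑-allSubsets-suc m _ ⟩
  ∑ (allSubsets m) (λ _ → 0ℚ) + ∑ (allSubsets m) (λ B → if disjoint A B then h (false ∷ B) else 0ℚ)
    ≡⟨ cong₂ _+_ (∑-zero (allSubsets m)) (∑-disjoint-reindex A (h ∘ (false ∷_))) ⟩
  0ℚ + rest
    ≡⟨ +-comm 0ℚ rest ⟩
  rest + 0ℚ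
    ≡⟨ cong (rest +_) (∑-zero (allSubsets m)) ⟨
  rest + ∑ (allSubsets m) (λ _ → 0ℚ)
    ≡⟨ ∑-allSubsets-suc m _ ⟨
  ∑ (allSubsets (ℕ.suc m)) (λ S → if (true ∷ A) ⊆ᵇ S then h (S ─ (true ∷ A)) else 0ℚ) ∎
  where
  open ≡-Reasoning
  rest : ℚ
  rest = ∑ (allSubsets m) (λ S → if A ⊆ᵇ S then h (false ∷ (S ─ A)) else 0ℚ)
∑-disjoint-reindex {ℕ.suc m} (false ∷ A) h = begin
  ∑ (allSubsets (ℕ.suc m)) (λ B → if disjoint (false ∷ A) B then h B else 0ℚ)
    ≡⟨ ∑-allSubsets-suc m _ ⟩
  ∑ (allSubsets m) (λ B → if disjoint A B then h (true ∷ B) else 0ℚ)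
    + ∑ (allSubsets m) (λ B → if disjoint A B then h (false ∷ B) else 0ℚ)
    ≡⟨ cong₂ _+_ (∑-disjoint-reindex A (h ∘ (true ∷_))) (∑-disjoint-reindex A (h ∘ (false ∷_))) ⟩
  ∑ (allSubsets m) (λ S → if A ⊆ᵇ S then h (true ∷ (S ─ A)) else 0ℚ)
    + ∑ (allSubsets m) (λ S → if A ⊆ᵇ S then h (false ∷ (S ─ A)) else 0ℚ)
    ≡⟨ ∑-allSubsets-suc m _ ⟨
  ∑ (allSubsets (ℕ.suc m)) (λ S → if (false ∷ A) ⊆ᵇ S then h (S ─ (false ∷ A)) else 0ℚ) ∎
  where open ≡-Reasoning

module Binomial (x y : ℚ) where
  open ≡-Reasoning

  between : ∀ {m} → Vec Bool m → Vec Bool m → Vec Bool m → ℚ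
  between L S A = if A ⊆ᵇ S ∧ L ⊆ᵇ A then x ^ card A * y ^ card (S ─ A) else 0ℚ

  ∑-between : ∀ {m} (L S : Vec Bool m) → L ⊆ S →
              ∑ (allSubsets m) (between L S) ≡ x ^ card L * (x + y) ^ card (S ─ L)
  ∑-between []          []          _   = +-identityʳ (1ℚ * 1ℚ)
  ∑-between (true  ∷ L) (false ∷ S) L⊆S with L⊆S here
  ... | ()
  ∑-between (true  ∷ L) (true  ∷ S) L⊆S = begin
    ∑ (allSubsets _) (between (true ∷ L) (true ∷ S))
      ≡⟨ ∑-allSubsets-factor x 0ℚ _ (between L S) (λ A → if-*-assoc (A ⊆ᵇ S ∧ L ⊆ᵇ A) x _ _)
           (λ A → trans (if-∧-false (A ⊆ᵇ S)) (sym (*-zeroˡ (between L S A)))) ⟩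
    (x + 0ℚ) * ∑ (allSubsets _) (between L S)
      ≡⟨ cong₂ _*_ (+-identityʳ x) (∑-between L S (drop-∷-⊆ L⊆S)) ⟩
    x * (x ^ card L * (x + y) ^ card (S ─ L))
      ≡⟨ *-assoc x _ _ ⟨
    x ^ card (true ∷ L) * (x + y) ^ card ((true ∷ S) ─ (true ∷ L)) ∎
  ∑-between (false ∷ L) (true  ∷ S) L⊆S = begin
    ∑ (allSubsets _) (between (false ∷ L) (true ∷ S))
      ≡⟨ ∑-allSubsets-factor x y _ (between L S) (λ A → if-*-assoc (A ⊆ᵇ S ∧ L ⊆ᵇ A) x _ _)
           (λ A → if-*-left-comm (A ⊆ᵇ S ∧ L ⊆ᵇ A) y (x ^ card A) _) ⟩
    (x + y) * ∑ (allSubsets _) (between L S)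
      ≡⟨ cong ((x + y) *_) (∑-between L S (drop-∷-⊆ L⊆S)) ⟩
    (x + y) * (x ^ card L * (x + y) ^ card (S ─ L))
      ≡⟨ x*yz≡y*xz (x + y) (x ^ card L) _ ⟩
    x ^ card (false ∷ L) * (x + y) ^ card ((true ∷ S) ─ (false ∷ L)) ∎
  ∑-between (false ∷ L) (false ∷ S) L⊆S = begin
    ∑ (allSubsets _) (between (false ∷ L) (false ∷ S))
      ≡⟨ ∑-allSubsets-factor 0ℚ 1ℚ _ (between L S) (λ A → sym (*-zeroˡ (between L S A)))
           (λ A → sym (*-identityˡ (between L S A))) ⟩
    (0ℚ + 1ℚ) * ∑ (allSubsets _) (between L S)
      ≡⟨ *-identityˡ (∑ (allSubsets _) (between L S)) ⟩
    ∑ (allSubsets _) (between L S)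
      ≡⟨ ∑-between L S (drop-∷-⊆ L⊆S) ⟩
    x ^ card (false ∷ L) * (x + y) ^ card ((false ∷ S) ─ (false ∷ L)) ∎

^≡^ₛ : ∀ x k → x ^ k ≡ x ^ₛ k
^≡^ₛ x ℕ.zero    = refl
^≡^ₛ x (ℕ.suc k) = cong (x *_) (^≡^ₛ x k)

^-homo-* : ∀ x m k → x ^ (m ℕ.+ k) ≡ x ^ m * x ^ k
^-homo-* x m k =
  trans (^≡^ₛ x (m ℕ.+ k)) (trans (^ₛ-homo-* x m k) (sym (cong₂ _*_ (^≡^ₛ x m) (^≡^ₛ x k))))

^-distrib-* : ∀ x y k → (x * y) ^ k ≡ x ^ k * y ^ k
^-distrib-* x y k =
  trans (^≡^ₛ (x * y) k) (trans (^ₛ-distrib-* x y k) (sym (cong₂ _*_ (^≡^ₛ x k) (^≡^ₛ y k))))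

subtree-to-connector-weight : ∀ q r a b → q ^ (a ℕ.+ b) * r ^ a ≡ (q * r) ^ a * (q * r + q * (1ℚ - r)) ^ b
subtree-to-connector-weight q r a b = begin
  q ^ (a ℕ.+ b) * r ^ a                     ≡⟨ cong (_* r ^ a) (^-homo-* q a b) ⟩
  q ^ a * q ^ b * r ^ a                     ≡⟨ xy*z≡xz*y (q ^ a) (q ^ b) (r ^ a) ⟩
  q ^ a * r ^ a * q ^ b                     ≡⟨ cong₂ _*_ (^-distrib-* q r a) (cong (_^ b) qr+q[1-r]≡q) ⟨
  (q * r) ^ a * (q * r + q * (1ℚ - r)) ^ b  ∎
  where
  open ≡-Reasoning
  qr+q[1-r]≡q : q * r + q * (1ℚ - r) ≡ q
  qr+q[1-r]≡q = solve 2 (λ q r → q :* r :+ q :* (con 1ℚ :- r) := q) refl q r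
    where open +-*-Solver

connector-to-subtree-weight : ∀ x s .{{_ : NonZero s}} a b → x ^ a * s ^ b ≡ s ^ (a ℕ.+ b) * (x ÷ s) ^ a
connector-to-subtree-weight x s a b = begin
  x ^ a * s ^ b                ≡⟨ cong (λ z → z ^ a * s ^ b) s*[x÷s]≡x ⟨
  (s * (x ÷ s)) ^ a * s ^ b    ≡⟨ cong (_* s ^ b) (^-distrib-* s (x ÷ s) a) ⟩
  s ^ a * (x ÷ s) ^ a * s ^ b  ≡⟨ xy*z≡xz*y (s ^ a) (s ^ b) ((x ÷ s) ^ a) ⟨
  s ^ a * s ^ b * (x ÷ s) ^ a  ≡⟨ cong (_* (x ÷ s) ^ a) (^-homo-* s a b) ⟨
  s ^ (a ℕ.+ b) * (x ÷ s) ^ a  ∎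
  where
  open ≡-Reasoning
  s*[x÷s]≡x : s * (x ÷ s) ≡ x
  s*[x÷s]≡x = trans (x*yz≡y*xz s x (1/ s)) (trans (cong (x *_) (*-inverseʳ s)) (*-identityʳ x))

module Polynomials {n : ℕ} (T : Tree n) where
  open TreeEdges T
  open Binomial using (between; ∑-between)

  subsets : List (EdgeSet n)
  subsets = allSubsets n

  ∑-subtrees : (ℕ → ℕ → ℚ) → ℚ
  ∑-subtrees f =
    ∑ subsets (λ S → if isSubtree T S then f (card (leafEdges T S)) (card (S ─ leafEdges T S)) else 0ℚ)

  ∑-subtrees-cong : ∀ {f g} → (∀ a b → f a b ≡ g a b) → ∑-subtrees f ≡ ∑-subtrees g
  ∑-subtrees-cong f≗g = ∑-cong (λ S → if-cong-then (isSubtree T S) (f≗g _ _)) subsets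

  subtreePoly-by-leaves : ∀ q r → subtreePoly T q r ≡ ∑-subtrees (λ a b → q ^ (a ℕ.+ b) * r ^ a)
  subtreePoly-by-leaves q r = ∑-cong (λ S → if-cong-then (isSubtree T S)
    (cong (λ k → q ^ k * r ^ card (leafEdges T S)) (card-─ (leafEdges⊆ {S})))) subsets

  module _ (x y : ℚ) where

    term : EdgeSet n → EdgeSet n → ℚ
    term A B = if nonempty A ∧ isConnector T A B then x ^ card A * y ^ card B else 0ℚ

    term-disjoint : ∀ A B → term A B ≡ (if disjoint A B then term A B else 0ℚ)
    term-disjoint A B = if-implied λ h → proj₁ (∧-true⁻ {disjoint A B} (proj₂ (∧-true⁻ {nonempty A} h)))

    term-complement : ∀ S A → (if A ⊆ᵇ S then term A (S ─ A) else 0ℚ)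
                            ≡ (if isSubtree T S then between x y (leafEdges T S) S A else 0ℚ)
    term-complement S A = begin
      (if A ⊆ᵇ S then term A (S ─ A) else 0ℚ)
        ≡⟨ if-then-cong (A ⊆ᵇ S) (λ A⊆ᵇS → if-cong (connector-complement {A} {S} (⊆ᵇ⁻ A S A⊆ᵇS))) ⟩
      (if A ⊆ᵇ S then (if isSubtree T S ∧ (leafEdges T S ⊆ᵇ A) then V else 0ℚ) else 0ℚ)
        ≡⟨ if-cong-then (A ⊆ᵇ S) (if-∧ (isSubtree T S)) ⟩
      (if A ⊆ᵇ S then (if isSubtree T S then (if leafEdges T S ⊆ᵇ A then V else 0ℚ) else 0ℚ) else 0ℚ)
        ≡⟨ if-swap-then (A ⊆ᵇ S) (isSubtree T S) ⟩
      (if isSubtree T S then (if A ⊆ᵇ S then (if leafEdges T S ⊆ᵇ A then V else 0ℚ) else 0ℚ) else 0ℚ)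
        ≡⟨ if-cong-then (isSubtree T S) (if-∧ (A ⊆ᵇ S)) ⟨
      (if isSubtree T S then between x y (leafEdges T S) S A else 0ℚ) ∎
      where
      open ≡-Reasoning
      V : ℚ
      V = x ^ card A * y ^ card (S ─ A)

    connectorPoly-by-leaves : connectorPoly T x y ≡ ∑-subtrees (λ a b → x ^ a * (x + y) ^ b)
    connectorPoly-by-leaves = begin
      connectorPoly T x y
        ≡⟨ sumℚ-concatMap (λ A → map (term A) subsets) subsets ⟩
      ∑ subsets (λ A → ∑ subsets (term A))
        ≡⟨ ∑-cong (λ A → ∑-cong (term-disjoint A) subsets) subsets ⟩
      ∑ subsets (λ A → ∑ subsets (λ B → if disjoint A B then term A B else 0ℚ))
        ≡⟨ ∑-cong (λ A → ∑-disjoint-reindex A (term A)) subsets ⟩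
      ∑ subsets (λ A → ∑ subsets (λ S → if A ⊆ᵇ S then term A (S ─ A) else 0ℚ))
        ≡⟨ ∑-comm (λ A S → if A ⊆ᵇ S then term A (S ─ A) else 0ℚ) subsets subsets ⟩
      ∑ subsets (λ S → ∑ subsets (λ A → if A ⊆ᵇ S then term A (S ─ A) else 0ℚ))
        ≡⟨ ∑-cong (λ S → ∑-cong (term-complement S) subsets) subsets ⟩
      ∑ subsets (λ S → ∑ subsets (λ A → if isSubtree T S then between x y (leafEdges T S) S A else 0ℚ))
        ≡⟨ ∑-cong (λ S → ∑-if (isSubtree T S) (between x y (leafEdges T S) S) subsets) subsets ⟩
      ∑ subsets (λ S → if isSubtree T S then ∑ subsets (between x y (leafEdges T S) S) else 0ℚ)
        ≡⟨ ∑-cong (λ S → if-cong-then (isSubtree T S)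
                           (∑-between x y (leafEdges T S) S (leafEdges⊆ {S}))) subsets ⟩
      ∑-subtrees (λ a b → x ^ a * (x + y) ^ b) ∎
      where open ≡-Reasoning

proposition2p1 : ∀ {n : ℕ} (T : Tree n) →
      (∀ (q r : ℚ) → subtreePoly T q r ≡ connectorPoly T (q * r) (q * (1ℚ - r)))
    × (∀ (x y : ℚ) .{{_ : NonZero (x + y)}} →
         connectorPoly T x y ≡ subtreePoly T (x + y) (x ÷ (x + y)))
proposition2p1 T = part₁ , part₂
  where
  open Polynomials T
  part₁ : ∀ q r → subtreePoly T q r ≡ connectorPoly T (q * r) (q * (1ℚ - r))
  part₁ q r = trans (subtreePoly-by-leaves q r)
                (trans (∑-subtrees-cong (subtree-to-connector-weight q r))
                       (sym (connectorPoly-by-leaves (q * r) (q * (1ℚ - r)))))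
  part₂ : ∀ x y .{{_ : NonZero (x + y)}} → connectorPoly T x y ≡ subtreePoly T (x + y) (x ÷ (x + y))
  part₂ x y = trans (connectorPoly-by-leaves x y)
                (trans (∑-subtrees-cong (connector-to-subtree-weight x (x + y)))
                       (sym (subtreePoly-by-leaves (x + y) (x ÷ (x + y)))))
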